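{- Assume $V$ satisfies (BF), (Cm), (Cn), (Cs). Let $A\Rightarrow B$ be a sequent, $x_1,\dots,x_n$ an admissible list of variables for $A\Rightarrow B$, and $p$ a permutation of $\{1,\dots,n\}$. Then for every $e\in\mathsf I_{n+1}$ there exists $e'\in\mathsf I_{n+1}$ such that for every evaluation $f$: $e\mathrel{\mathbf r^{V,\,x_{p(1)},\dots,x_{p(n)}}_f}A\Rightarrow B$ if and only if $e'\mathrel{\mathbf r^{V,\,x_1,\dots,x_n}_f}A\Rightarrow B$.
   Context: Let $\mathsf c:\mathbb N^2\to\mathbb N$ be a bijection with $\mathsf p_i(\mathsf c(a_1,a_2))=a_i$; $I^i_n(a_1,\dots,a_n)=a_i$. $V$ is a countable set of partial functions on $\mathbb N$ of arities $n\ge0$, $V_n$ its $n$-ary members; for each $n$ a numbering is fixed: $\mathsf I_n\subseteq\mathbb N$ and a surjection $e\mapsto\varphi^V_e$ from $\mathsf I_n$ onto $V_n$. $t_1\simeq t_2$: for all values of the variables, both sides undefined or both defined and equal. (BF): $I^i_n,\mathsf c,\mathsf p_1,\mathsf p_2\in V$. (Cm): for all $n,m_1,\dots,m_n$, $m=\max m_i$, some $(n+1)$-ary $s\in V$ gives $s(e,e_1,\dots,e_n)\in\mathsf I_m$ with $\varphi^V_{s(e,e_1,\dots,e_n)}(x_1,\dots,x_m)\simeq\varphi^V_e(\varphi^V_{e_1}(x_1,\dots,x_{m_1}),\dots,\varphi^V_{e_n}(x_1,\dots,x_{m_n}))$ for $e\in\mathsf I_n,e_i\in\mathsf I_{m_i}$.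 (Cn): some $s\in V$ has $s(k)\in\mathsf I_0$, $\varphi^V_{s(k)}\simeq k$ for all $k$. (Cs): for each $n$ some $s\in V$ gives, for $e_1,e_2\in\mathsf I_{n+1}$, $s(e_1,e_2)\in\mathsf I_{n+1}$ with $\varphi^V_{s(e_1,e_2)}(\bar x,d)\simeq\varphi^V_{e_1}(\bar x,d)$ if $\mathsf p_1d=0$ and $\simeq\varphi^V_{e_2}(\bar x,d)$ otherwise. Formulas of $L^M_{\mathsf{BQC}}$ ($M\subseteq\mathbb N$ used as constants) are built from atoms $\bot,\top,P(t_1,\dots,t_n)$ ($P$ a predicate symbol, $t_i$ variables or elements of $M$) by $\land$, $\lor$, $\forall\bar x(A\to B)$ ($\bar x$ a possibly empty list of distinct variables) and $\exists y$. A sequent is $A\Rightarrow B$ with $A,B$ formulas without constants. An $M$-evaluation $f$ maps each $n$-ary predicate symbol $P$ to a total map $P^f:M^n\to2^{\mathbb N}$; an evaluation is an $M$-evaluation for some $M$. Realizability of $M$-sentences: none for $\bot$; all $e$ for $\top$; $e\mathrel{\mathbf r^V_f}P(\bar a)$ iff $e\in P^f(\bar a)$; conjunction: $\mathsf p_1e,\mathsf p_2e$ realize the conjuncts; disjunction: $\mathsf p_1e=0$ and $\mathsf p_2e$ realizes the left disjunct, or $\mathsf p_1e=1$ and $\mathsf p_2 e$ realizes the right; $\exists x\Phi(x)$: $\mathsf p_1e\in M$ and $\mathsf p_2e\mathrel{\mathbf r^V_f}\Phi(\mathsf p_1e)$; $\forall x_1,\dots,x_n(\Phi\to\Psi)$: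 $e\in\mathsf I_{n+1}$ and for all $s\in\mathbb N$, $a_1,\dots,a_n\in M$, if $s\mathrel{\mathbf r^V_f}\Phi(\bar a)$ then $\varphi^V_e(\bar a,s)$ is defined and realizes $\Psi(\bar a)$. A list of distinct variables $\bar x$ is admissible for $A\Rightarrow B$ if all free variables of $A,B$ are in $\bar x$; $e\mathrel{\mathbf r^{V,\bar x}_f}A\Rightarrow B$ means $e\mathrel{\mathbf r^V_f}\forall\bar x(A\to B)$ (the variables quantified in the listed order). -}

module Defs where

open import Data.Nat using (ℕ; zero; suc; _⊔_; _≟_)
open import Data.Fin using (Fin)
open import Data.Vec using (Vec; []; _∷_; lookup; tabulate; _∷ʳ_; map)
open import Data.Vec.Membership.Propositional using (_∈_; _∉_)
open import Data.Vec.Relation.Unary.Unique.Propositional using (Unique)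
open import Data.Fin.Permutation using (Permutation′; _⟨$⟩ʳ_)
open import Data.Product using (Σ; _×_; _,_; ∃)
open import Data.Sum using (_⊎_)
open import Data.Empty using (⊥)
open import Data.Unit using (⊤)
open import Relation.Binary.PropositionalEquality using (_≡_; _≢_)
open import Relation.Nullary using (yes; no)

Iff : ∀ {a b} → Set a → Set b → Set _
Iff A B = (A → B) × (B → A)

maxV : ∀ {n} → Vec ℕ n → ℕ
maxV []       = 0
maxV (m ∷ ms) = m ⊔ maxV ms

data Prefix : ∀ {k m} → Vec ℕ k → Vec ℕ m → Set where
  []  : ∀ {m} {xs : Vec ℕ m} → Prefix [] xs
  _∷_ : ∀ x {k m} {ys : Vec ℕ k} {xs : Vec ℕ m} →
        Prefix ys xs → Prefix (x ∷ ys) (x ∷ xs)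

-- A partial n-ary function is represented by its graph
-- (a relation  Vec ℕ n → ℕ → Set  that is single-valued);
-- V_n is the image of the numbering  e ↦ φ n e  on the index set I n.

record Setting : Set₁ where
  field
    c  : ℕ → ℕ → ℕ
    p₁ : ℕ → ℕ
    p₂ : ℕ → ℕ
    c-injective  : ∀ a b a' b' → c a b ≡ c a' b' → (a ≡ a') × (b ≡ b')
    c-surjective : ∀ d → Σ ℕ λ a → Σ ℕ λ b → c a b ≡ d
    p₁-c : ∀ a b → p₁ (c a b) ≡ a
    p₂-c : ∀ a b → p₂ (c a b) ≡ b
    I  : ℕ → ℕ → Set
    -- φ n e xs y : φ^V_e(xs) is defined with value y
    φ  : (n : ℕ) → ℕ → Vec ℕ n → ℕ → Set
    φ-functional : ∀ n e → I n e → ∀ xs y z → φ n e xs y → φ n e xs z → y ≡ z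

module _ (S : Setting) where
  open Setting S

  TotalInV : (n : ℕ) → (Vec ℕ n → ℕ) → Set
  TotalInV n g = Σ ℕ λ k → I n k × (∀ xs y → Iff (φ n k xs y) (y ≡ g xs))

  BF : Set
  BF = (∀ n (i : Fin n) → TotalInV n (λ xs → lookup xs i))
     × TotalInV 2 (λ { (a ∷ b ∷ []) → c a b })
     × TotalInV 1 (λ { (d ∷ []) → p₁ d })
     × TotalInV 1 (λ { (d ∷ []) → p₂ d })

  -- graph of  φ_e(φ_{e_1}(x_1..x_{m_1}), …, φ_{e_n}(x_1..x_{m_n}))  at xs
  CompGraph : ∀ n (ms : Vec ℕ n) (e : ℕ) (es : Vec ℕ n) →
              Vec ℕ (maxV ms) → ℕ → Set
  CompGraph n ms e es xs z =
    Σ (Vec ℕ n) λ ws →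
      (∀ (i : Fin n) → Σ (Vec ℕ (lookup ms i)) λ ys →
          Prefix ys xs × φ (lookup ms i) (lookup es i) ys (lookup ws i))
      × φ n e ws z

  Cm : Set
  Cm = ∀ n (ms : Vec ℕ n) → Σ ℕ λ s → I (suc n) s ×
         (∀ e (es : Vec ℕ n) → I n e → (∀ i → I (lookup ms i) (lookup es i)) →
           Σ ℕ λ y → φ (suc n) s (e ∷ es) y × I (maxV ms) y ×
             (∀ xs z → Iff (φ (maxV ms) y xs z) (CompGraph n ms e es xs z)))

  Cn : Set
  Cn = Σ ℕ λ s → I 1 s ×
         (∀ k → Σ ℕ λ y → φ 1 s (k ∷ []) y × I 0 y ×
           (∀ z → Iff (φ 0 y [] z) (z ≡ k)))

  Cs : Set
  Cs = ∀ n → Σ ℕ λ s → I 2 s ×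
         (∀ e₁ e₂ → I (suc n) e₁ → I (suc n) e₂ →
           Σ ℕ λ y → φ 2 s (e₁ ∷ e₂ ∷ []) y × I (suc n) y ×
             (∀ (xs : Vec ℕ n) d z → Iff (φ (suc n) y (xs ∷ʳ d) z)
                 ((p₁ d ≡ 0 × φ (suc n) e₁ (xs ∷ʳ d) z)
                  ⊎ (p₁ d ≢ 0 × φ (suc n) e₂ (xs ∷ʳ d) z))))

-- Formulas of BQC without constants (variables are natural numbers).
-- Predicate symbols: P^n_k  (arity n, name k).

data Formula : Set where
  ⊥'   : Formula
  ⊤'   : Formula
  atom : (n k : ℕ) → Vec ℕ n → Formula
  _∧'_ : Formula → Formula → Formula
  _∨'_ : Formula → Formula → Formula
  -- ∀ x₁…xₙ (A → B)
  all' : (n : ℕ) → Vec ℕ n → Formula → Formula → Formula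
  ex'  : ℕ → Formula → Formula

WF : Formula → Set
WF ⊥'             = ⊤
WF ⊤'             = ⊤
WF (atom n k xs)  = ⊤
WF (A ∧' B)       = WF A × WF B
WF (A ∨' B)       = WF A × WF B
WF (all' n xs A B) = Unique xs × WF A × WF B
WF (ex' y A)      = WF A

data Free (x : ℕ) : Formula → Set where
  atom : ∀ {n k xs} → x ∈ xs → Free x (atom n k xs)
  ∧l   : ∀ {A B} → Free x A → Free x (A ∧' B)
  ∧r   : ∀ {A B} → Free x B → Free x (A ∧' B)
  ∨l   : ∀ {A B} → Free x A → Free x (A ∨' B)
  ∨r   : ∀ {A B} → Free x B → Free x (A ∨' B)
  alll : ∀ {n xs A B} → x ∉ xs → Free x A → Free x (all' n xs A B)
  allr : ∀ {n xs A B} → x ∉ xs → Free x B → Free x (all' n xs A B)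
  ex   : ∀ {y A} → x ≢ y → Free x A → Free x (ex' y A)

Admissible : ∀ {n} → Vec ℕ n → Formula → Formula → Set
Admissible xs A B = Unique xs × (∀ x → Free x A → x ∈ xs) × (∀ x → Free x B → x ∈ xs)

-- An evaluation: P^n_k ↦ P^f : ℕ^n → 2^ℕ (only arguments in M are ever used)
Evaluation : Set₁
Evaluation = (n k : ℕ) → Vec ℕ n → ℕ → Set

Env : Set
Env = ℕ → ℕ

upd : ℕ → ℕ → Env → Env
upd x a ρ y with y ≟ x
... | yes _ = a
... | no  _ = ρ y

updV : ∀ {n} → Vec ℕ n → Vec ℕ n → Env → Env
updV []       []       ρ = ρ
updV (x ∷ xs) (a ∷ as) ρ = upd x a (updV xs as ρ)

module _ (S : Setting) (M : ℕ → Set) (f : Evaluation) where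
  open Setting S

  -- e 𝐫^V_f Φ[ρ]  (Φ with its free variables instantiated by ρ)
  Real : Env → Formula → ℕ → Set
  Real ρ ⊥' e = ⊥
  Real ρ ⊤' e = ⊤
  Real ρ (atom n k xs) e = f n k (map ρ xs) e
  Real ρ (A ∧' B) e = Real ρ A (p₁ e) × Real ρ B (p₂ e)
  Real ρ (A ∨' B) e = (p₁ e ≡ 0 × Real ρ A (p₂ e)) ⊎ (p₁ e ≡ 1 × Real ρ B (p₂ e))
  Real ρ (all' n xs A B) e =
    I (suc n) e ×
    (∀ (s : ℕ) (as : Vec ℕ n) → (∀ (i : Fin n) → M (lookup as i)) →
       Real (updV xs as ρ) A s →
       Σ ℕ λ y → φ (suc n) e (as ∷ʳ s) y × Real (updV xs as ρ) B y)
  Real ρ (ex' y A) e = M (p₁ e) × Real (upd y (p₁ e) ρ) A (p₂ e)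

  -- e 𝐫^{V,x̄}_f A ⇒ B  :=  e 𝐫^V_f ∀x̄(A → B)  (a sentence when x̄ is admissible,
  -- so the base environment is irrelevant)
  RealSeq : ∀ {n} → Vec ℕ n → Formula → Formula → ℕ → Set
  RealSeq {n} xs A B e = Real (λ _ → 0) (all' n xs A B) e

permuteV : ∀ {n} → Permutation′ n → Vec ℕ n → Vec ℕ n
permuteV p xs = tabulate (λ i → lookup xs (p ⟨$⟩ʳ i))

-- The argument list of a realizer of  ∀x_{p(1)}…x_{p(n)}(A → B)  is
-- (x_{p(1)},…,x_{p(n)},s); a realizer of  ∀x₁…xₙ(A → B)  receives
-- (x₁,…,xₙ,s).  So e' is e precomposed with the substitution of variables
-- (x₁,…,xₙ,s) ↦ (x_{p(1)},…,x_{p(n)},s).  Only (BF) and (Cm) are needed.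
module Submission where

open import Defs
open import Data.Nat using (ℕ; zero; suc; _≟_; _⊔_)
open import Data.Nat.Properties using (⊔-idem; ⊔-identityʳ)
open import Data.Fin using (Fin; inject₁; fromℕ)
open import Data.Fin.Permutation using (Permutation′; _⟨$⟩ʳ_; _⟨$⟩ˡ_; inverseˡ; inverseʳ; flip)
open import Data.Vec using (Vec; []; _∷_; lookup; tabulate; _∷ʳ_; map; replicate)
open import Data.Vec.Properties using (lookup∘tabulate; lookup-map; map-cong; lookup-replicate; map-∷ʳ; tabulate-∘; tabulate-cong)
open import Data.Vec.Relation.Binary.Pointwise.Extensional using (ext; Pointwise-≡⇒≡)
open import Data.Vec.Relation.Unary.Any using (here; there; index)
open import Data.Vec.Relation.Unary.Any.Properties using (lookup-index)
open import Data.Vec.Membership.Propositional using (_∈_; _∉_)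
open import Data.Vec.Membership.Propositional.Properties using (∈-lookup)
open import Data.Vec.Membership.DecPropositional _≟_ using (_∈?_)
open import Data.Vec.Relation.Unary.Unique.Propositional using (Unique)
open import Data.Vec.Relation.Unary.Unique.Propositional.Properties using (lookup-injective)
open import Data.Product using (Σ; _×_; _,_; proj₁; proj₂)
open import Data.Sum using (inj₁; inj₂)
open import Data.Empty using (⊥-elim)
open import Relation.Nullary using (yes; no)
open import Relation.Binary.PropositionalEquality
open import Function using (_∘_)

iff-trans : ∀ {a b c} {P : Set a} {Q : Set b} {R : Set c} → Iff P Q → Iff Q R → Iff P R
iff-trans (pq , qp) (qr , rq) = qr ∘ pq , qp ∘ rq

_≐_ : Env → Env → Set
ρ ≐ ρ' = ∀ x → ρ x ≡ ρ' x

upd-cong : ∀ x a {ρ ρ'} → ρ ≐ ρ' → upd x a ρ ≐ upd x a ρ'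
upd-cong x a ρ≐ρ' y with y ≟ x
... | yes _ = refl
... | no  _ = ρ≐ρ' y

updV-cong : ∀ {n} (xs as : Vec ℕ n) {ρ ρ'} → ρ ≐ ρ' → updV xs as ρ ≐ updV xs as ρ'
updV-cong []       []       ρ≐ρ' = ρ≐ρ'
updV-cong (x ∷ xs) (a ∷ as) ρ≐ρ' = upd-cong x a (updV-cong xs as ρ≐ρ')

updV-outside : ∀ {n} (ys bs : Vec ℕ n) ρ x → x ∉ ys → updV ys bs ρ x ≡ ρ x
updV-outside []       []       ρ x x∉ = refl
updV-outside (y ∷ ys) (b ∷ bs) ρ x x∉ with x ≟ y
... | yes x≡y = ⊥-elim (x∉ (here x≡y))
... | no  _   = updV-outside ys bs ρ x (x∉ ∘ there)

updV-inside : ∀ {n} (ys bs : Vec ℕ n) ρ x → x ∈ ys →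
              Σ (Fin n) λ j → lookup ys j ≡ x × updV ys bs ρ x ≡ lookup bs j
updV-inside (y ∷ ys) (b ∷ bs) ρ x x∈ with x ≟ y
... | yes x≡y = Fin.zero , sym x≡y , refl
updV-inside (y ∷ ys) (b ∷ bs) ρ x (here x≡y)  | no x≢y = ⊥-elim (x≢y x≡y)
updV-inside (y ∷ ys) (b ∷ bs) ρ x (there x∈) | no _ with updV-inside ys bs ρ x x∈
... | j , at-j , value = Fin.suc j , at-j , value

updV-lookup : ∀ {n} (ys bs : Vec ℕ n) ρ → Unique ys → ∀ j → updV ys bs ρ (lookup ys j) ≡ lookup bs j
updV-lookup ys bs ρ unique j with updV-inside ys bs ρ (lookup ys j) (∈-lookup j ys)
... | i , at-i , value = trans value (cong (lookup bs) (lookup-injective unique i j at-i))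

permuteV-lookup : ∀ {n} (p : Permutation′ n) (xs : Vec ℕ n) j →
                  lookup (permuteV p xs) j ≡ lookup xs (p ⟨$⟩ʳ j)
permuteV-lookup p xs j = lookup∘tabulate _ j

permuteV-all : ∀ {n} (P : ℕ → Set) (p : Permutation′ n) (as : Vec ℕ n) →
               (∀ i → P (lookup as i)) → ∀ i → P (lookup (permuteV p as) i)
permuteV-all P p as all-P i = subst P (sym (permuteV-lookup p as i)) (all-P (p ⟨$⟩ʳ i))

permuteV-flip : ∀ {n} (p : Permutation′ n) (bs : Vec ℕ n) → permuteV p (permuteV (flip p) bs) ≡ bs
permuteV-flip p bs = Pointwise-≡⇒≡ (ext λ i → begin
  lookup (permuteV p (permuteV (flip p) bs)) i  ≡⟨ permuteV-lookup p (permuteV (flip p) bs) i ⟩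
  lookup (permuteV (flip p) bs) (p ⟨$⟩ʳ i)      ≡⟨ permuteV-lookup (flip p) bs _ ⟩
  lookup bs (p ⟨$⟩ˡ (p ⟨$⟩ʳ i))                 ≡⟨ cong (lookup bs) (inverseˡ p) ⟩
  lookup bs i                                    ∎)
  where open ≡-Reasoning

∈-permuteV : ∀ {n} (p : Permutation′ n) (xs : Vec ℕ n) {x} → x ∈ xs → x ∈ permuteV p xs
∈-permuteV p xs {x} x∈ = subst (_∈ permuteV p xs) (sym at-k) (∈-lookup (p ⟨$⟩ˡ k) (permuteV p xs))
  where
  k = index x∈
  at-k : x ≡ lookup (permuteV p xs) (p ⟨$⟩ˡ k)
  at-k = trans (lookup-index x∈)
           (sym (trans (permuteV-lookup p xs _) (cong (lookup xs) (inverseʳ p))))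

updV-permute : ∀ {n} (p : Permutation′ n) (xs as : Vec ℕ n) ρ → Unique xs →
               updV (permuteV p xs) (permuteV p as) ρ ≐ updV xs as ρ
updV-permute p xs as ρ unique x with x ∈? permuteV p xs
... | no x∉ = trans (updV-outside _ _ ρ x x∉) (sym (updV-outside xs as ρ x (x∉ ∘ ∈-permuteV p xs)))
... | yes x∈ with updV-inside (permuteV p xs) (permuteV p as) ρ x x∈
...   | j , refl , value = begin
  updV (permuteV p xs) (permuteV p as) ρ (lookup (permuteV p xs) j) ≡⟨ value ⟩
  lookup (permuteV p as) j                                            ≡⟨ permuteV-lookup p as j ⟩
  lookup as (p ⟨$⟩ʳ j)                                                ≡⟨ sym (updV-lookup xs as ρ unique _) ⟩
  updV xs as ρ (lookup xs (p ⟨$⟩ʳ j))                                 ≡⟨ cong (updV xs as ρ) (sym (permuteV-lookup p xs j)) ⟩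
  updV xs as ρ (lookup (permuteV p xs) j)                             ∎
  where open ≡-Reasoning

module Realizability (S : Setting) (M : ℕ → Set) (f : Evaluation) where
  open Setting S

  real-cong : ∀ A {ρ ρ'} → ρ ≐ ρ' → ∀ e → Real S M f ρ A e → Real S M f ρ' A e
  real-cong ⊥'            ρ≐ρ' e ()
  real-cong ⊤'            ρ≐ρ' e r = r
  real-cong (atom n k xs) ρ≐ρ' e r = subst (λ v → f n k v e) (map-cong ρ≐ρ' xs) r
  real-cong (A ∧' B)      ρ≐ρ' e (rA , rB) = real-cong A ρ≐ρ' _ rA , real-cong B ρ≐ρ' _ rB
  real-cong (A ∨' B)      ρ≐ρ' e (inj₁ (tag , r)) = inj₁ (tag , real-cong A ρ≐ρ' _ r)
  real-cong (A ∨' B)      ρ≐ρ' e (inj₂ (tag , r)) = inj₂ (tag , real-cong B ρ≐ρ' _ r)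
  real-cong (all' n xs A B) ρ≐ρ' e (Ie , respond) = Ie , λ s as M-as rA →
    let (z , φz , rB) = respond s as M-as (real-cong A (updV-cong xs as (sym ∘ ρ≐ρ')) s rA)
    in  z , φz , real-cong B (updV-cong xs as ρ≐ρ') z rB
  real-cong (ex' y A)     ρ≐ρ' e (M-a , r) = M-a , real-cong A (upd-cong y _ ρ≐ρ') _ r

  Responds : Env → Formula → Formula → ℕ → (ℕ → Set) → Set
  Responds ρ A B s g = Real S M f ρ A s → Σ ℕ λ z → g z × Real S M f ρ B z

  responds-transfer : ∀ A B {ρ ρ' s} {g h : ℕ → Set} → ρ ≐ ρ' → (∀ z → g z → h z) →
                      Responds ρ A B s g → Responds ρ' A B s h
  responds-transfer A B ρ≐ρ' g⇒h respond rA =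
    let (z , gz , rB) = respond (real-cong A (sym ∘ ρ≐ρ') _ rA)
    in  z , g⇒h z gz , real-cong B ρ≐ρ' z rB

  permute-bound : ∀ {n} (p : Permutation′ n) (xs : Vec ℕ n) → Unique xs →
    ∀ {e y} → I (suc n) e → I (suc n) y →
    (∀ as s z → Iff (φ (suc n) y (as ∷ʳ s) z) (φ (suc n) e (permuteV p as ∷ʳ s) z)) →
    ∀ A B ρ → Iff (Real S M f ρ (all' n (permuteV p xs) A B) e) (Real S M f ρ (all' n xs A B) y)
  permute-bound p xs unique {e} {y} Ie Iy y≃e A B ρ = to , from
    where
    same-env : ∀ as → updV (permuteV p xs) (permuteV p as) ρ ≐ updV xs as ρ
    same-env as = updV-permute p xs as ρ unique

    to : Real S M f ρ (all' _ (permuteV p xs) A B) e → Real S M f ρ (all' _ xs A B) y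
    to (_ , respond) = Iy , λ s as M-as →
      responds-transfer A B (same-env as) (λ z → proj₂ (y≃e as s z))
        (respond s (permuteV p as) (permuteV-all M p as M-as))

    from : Real S M f ρ (all' _ xs A B) y → Real S M f ρ (all' _ (permuteV p xs) A B) e
    from (_ , respond) = Ie , λ s bs M-bs →
      let as = permuteV (flip p) bs
      in  subst (λ v → Responds (updV (permuteV p xs) v ρ) A B s (φ _ e (v ∷ʳ s)))
            (permuteV-flip p bs)
            (responds-transfer A B (sym ∘ same-env as) (λ z → proj₁ (y≃e as s z))
              (respond s as (permuteV-all M (flip p) bs M-bs)))

-- With all arities equal to m, the arity of a composite in (Cm) is m.
maxV-replicate : ∀ k m → maxV (replicate (suc k) m) ≡ m
maxV-replicate zero    m = ⊔-identityʳ m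
maxV-replicate (suc k) m = trans (cong (m ⊔_) (maxV-replicate k m)) (⊔-idem m)

prefix-refl : ∀ {k} (xs : Vec ℕ k) → Prefix xs xs
prefix-refl []       = []
prefix-refl (x ∷ xs) = x ∷ prefix-refl xs

prefix-whole : ∀ {k} {ys xs : Vec ℕ k} → Prefix ys xs → ys ≡ xs
prefix-whole {xs = []}    []          = refl
prefix-whole              (x ∷ ys⊑xs) = cong (x ∷_) (prefix-whole ys⊑xs)

lookup-∷ʳ-inject₁ : ∀ {n} (as : Vec ℕ n) s j → lookup (as ∷ʳ s) (inject₁ j) ≡ lookup as j
lookup-∷ʳ-inject₁ (a ∷ as) s Fin.zero    = refl
lookup-∷ʳ-inject₁ (a ∷ as) s (Fin.suc j) = lookup-∷ʳ-inject₁ as s j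

lookup-∷ʳ-last : ∀ {n} (as : Vec ℕ n) s → lookup (as ∷ʳ s) (fromℕ n) ≡ s
lookup-∷ʳ-last []       s = refl
lookup-∷ʳ-last (a ∷ as) s = lookup-∷ʳ-last as s

module Substitution (S : Setting) (bf : BF S) (cm : Cm S) where
  open Setting S

  Reindexes : ∀ {k m} → Vec (Fin m) k → ℕ → ℕ → Set
  Reindexes {k} {m} R e y = I m y × (∀ X z → Iff (φ m y X z) (φ k e (map (lookup X) R) z))

  projIndex : (m : ℕ) → Fin m → ℕ
  projIndex m j = proj₁ (proj₁ bf m j)

  -- Arities in (Cm) are  lookup ms i , only propositionally equal to the
  -- intended one; these two facts absorb that equation.
  projection-on-prefix : ∀ {L K} → L ≡ K → (ys : Vec ℕ L) (X : Vec ℕ K) → Prefix ys X →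
                         ∀ j w → Iff (φ L (projIndex K j) ys w) (w ≡ lookup X j)
  projection-on-prefix refl ys X ys⊑X j w rewrite prefix-whole ys⊑X = proj₂ (proj₂ (proj₁ bf _ j)) X w

  whole-prefix : ∀ {L K} → L ≡ K → (X : Vec ℕ K) → Σ (Vec ℕ L) λ ys → Prefix ys X
  whole-prefix refl X = X , prefix-refl X

  -- Substitution of variables when (Cm) is used with all arities equal to
  -- K = maxV ms: compose e with the projections I^{R(i)}_K.
  reindex-uniform : ∀ {k} (ms : Vec ℕ (suc k)) → (∀ i → lookup ms i ≡ maxV ms) →
                    (R : Vec (Fin (maxV ms)) (suc k)) → ∀ e → I (suc k) e → Σ ℕ (Reindexes R e)
  reindex-uniform {k} ms uniform R e Ie =
    let (y , _ , Iy , graph) = proj₂ (proj₂ (cm (suc k) ms)) e es Ie es-I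
    in  y , Iy , λ X z → iff-trans (graph X z) (composite X z)
    where
    K  = maxV ms
    es = map (projIndex K) R

    es-I : ∀ i → I (lookup ms i) (lookup es i)
    es-I i = subst₂ I (sym (uniform i)) (sym (lookup-map i _ R)) (proj₁ (proj₂ (proj₁ bf K (lookup R i))))

    component : ∀ X i ys → Prefix ys X → ∀ w →
                Iff (φ (lookup ms i) (lookup es i) ys w) (w ≡ lookup (map (lookup X) R) i)
    component X i ys ys⊑X w =
      (λ φw → trans (proj₁ spec (subst (λ c → φ _ c ys w) (lookup-map i _ R) φw)) (sym (lookup-map i (lookup X) R)))
      , (λ w≡ → subst (λ c → φ _ c ys w) (sym (lookup-map i _ R)) (proj₂ spec (trans w≡ (lookup-map i (lookup X) R))))
      where
      spec = projection-on-prefix (uniform i) ys X ys⊑X (lookup R i) w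

    composite : ∀ X z → Iff (CompGraph S (suc k) ms e es X z) (φ (suc k) e (map (lookup X) R) z)
    composite X z = to , from
      where
      to : CompGraph S (suc k) ms e es X z → φ (suc k) e (map (lookup X) R) z
      to (ws , inner , φe) = subst (λ v → φ (suc k) e v z) (Pointwise-≡⇒≡ (ext λ i →
        let (ys , ys⊑X , φi) = inner i in proj₁ (component X i ys ys⊑X _) φi)) φe

      from : φ (suc k) e (map (lookup X) R) z → CompGraph S (suc k) ms e es X z
      from φe = map (lookup X) R , (λ i →
        let (ys , ys⊑X) = whole-prefix (uniform i) X
        in  ys , ys⊑X , proj₂ (component X i ys ys⊑X _) refl) , φe

  reindex : ∀ k m (R : Vec (Fin m) (suc k)) e → I (suc k) e → Σ ℕ (Reindexes R e)
  reindex k m R e Ie = at (maxV-replicate k m) R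
    where
    ms = replicate (suc k) m

    uniform : ∀ i → lookup ms i ≡ maxV ms
    uniform i = trans (lookup-replicate i m) (sym (maxV-replicate k m))

    at : ∀ {m'} → maxV ms ≡ m' → (R' : Vec (Fin m') (suc k)) → Σ ℕ (Reindexes R' e)
    at refl R' = reindex-uniform ms uniform R' e Ie

-- The positions (p(1),…,p(n),n+1): the substitution  (x̄,s) ↦ (x_{p(1)},…,x_{p(n)},s).
permutePositions : ∀ {n} → Permutation′ n → Vec (Fin (suc n)) (suc n)
permutePositions {n} p = tabulate (inject₁ ∘ (p ⟨$⟩ʳ_)) ∷ʳ fromℕ n

map-lookup-permutePositions : ∀ {n} (p : Permutation′ n) (as : Vec ℕ n) s →
  map (lookup (as ∷ʳ s)) (permutePositions p) ≡ permuteV p as ∷ʳ s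
map-lookup-permutePositions {n} p as s = begin
  map (lookup (as ∷ʳ s)) (tabulate (inject₁ ∘ (p ⟨$⟩ʳ_)) ∷ʳ fromℕ n)
    ≡⟨ map-∷ʳ _ (fromℕ n) _ ⟩
  map (lookup (as ∷ʳ s)) (tabulate (inject₁ ∘ (p ⟨$⟩ʳ_))) ∷ʳ lookup (as ∷ʳ s) (fromℕ n)
    ≡⟨ cong₂ _∷ʳ_ (sym (tabulate-∘ _ _)) (lookup-∷ʳ-last as s) ⟩
  tabulate (lookup (as ∷ʳ s) ∘ inject₁ ∘ (p ⟨$⟩ʳ_)) ∷ʳ s
    ≡⟨ cong (_∷ʳ s) (tabulate-cong (λ j → lookup-∷ʳ-inject₁ as s (p ⟨$⟩ʳ j))) ⟩
  permuteV p as ∷ʳ s ∎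
  where open ≡-Reasoning

lemma2p5 : (S : Setting) → BF S → Cm S → Cn S → Cs S →
    (A B : Formula) → WF A → WF B →
    (n : ℕ) (xs : Vec ℕ n) → Admissible xs A B →
    (p : Permutation′ n) →
    (e : ℕ) → Setting.I S (suc n) e →
    Σ ℕ λ e' → Setting.I S (suc n) e' ×
    ((M : ℕ → Set) (f : Evaluation) →
    Iff (RealSeq S M f (permuteV p xs) A B e) (RealSeq S M f xs A B e'))
lemma2p5 S bf cm _ _ A B _ _ n xs (unique , _ , _) p e Ie =
  e' , Ie' , λ M f → Realizability.permute-bound S M f p xs unique Ie Ie' e'≃e A B (λ _ → 0)
  where
  open Setting S
  reindexed = Substitution.reindex S bf cm n (suc n) (permutePositions p) e Ie
  e'  = proj₁ reindexed
  Ie' = proj₁ (proj₂ reindexed)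

  e'≃e : ∀ as s z → Iff (φ (suc n) e' (as ∷ʳ s) z) (φ (suc n) e (permuteV p as ∷ʳ s) z)
  e'≃e as s z = subst (λ v → Iff (φ (suc n) e' (as ∷ʳ s) z) (φ (suc n) e v z))
                  (map-lookup-permutePositions p as s) (proj₂ (proj₂ reindexed) (as ∷ʳ s) z)
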